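{- For every labelled formula $L$ of $\mathsf{CPL}_0$, if the sequent $\vdash L$ is derivable in the proof system for $\mathsf{CPL}_0$, then $\vdash L$ is valid.
   Context: Let $2^\omega=\{0,1\}^{\mathbb N}$ with its Borel $\sigma$-algebra and the standard fair-coin measure $\mu$; $\mathrm{Cyl}(i)=\{f\in 2^\omega\mid f(i)=1\}$. Formulas of $\mathsf{CPL}_0$: $A,B::= \mathbf i\mid\neg A\mid A\wedge B\mid A\vee B\mid \mathbf C^qA\mid \mathbf D^qA$ with $i\in\mathbb N$, $q\in\mathbb Q\cap[0,1]$. Semantics $[\![A]\!]\subseteq 2^\omega$: $[\![\mathbf i]\!]=\mathrm{Cyl}(i)$; $\neg,\wedge,\vee$ are complement, intersection, union; $[\![\mathbf C^qA]\!]=2^\omega$ if $\mu([\![A]\!])\ge q$ and $\emptyset$ otherwise; $[\![\mathbf D^qA]\!]=2^\omega$ if $\mu([\![A]\!])<q$ and $\emptyset$ otherwise. Boolean formulas: $\mathscr b,\mathscr c::=x_i\mid\top\mid\bot\mid\neg\mathscr b\mid \mathscr b\wedge\mathscr c\mid\mathscr b\vee\mathscr c$, with $[\![x_i]\!]=\mathrm{Cyl}(i)$, $[\![\top]\!]=2^\omega$, $[\![\bot]\!]=\emptyset$, and connectives as set operations. $\mathscr b\vDash\mathscr c$ means $[\![\mathscr b]\!]\subseteq[\![\mathscr c]\!]$. A labelled formula is $\mathscr b\rightarrowtail A$ or $\mathscr b\leftarrowtail A$; a sequent is $\vdash L$ with $L$ labelled. $\mathscr b\rightarrowtail A$ (resp.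 $\mathscr b\leftarrowtail A$) is valid iff $[\![\mathscr b]\!]\subseteq[\![A]\!]$ (resp. $[\![A]\!]\subseteq[\![\mathscr b]\!]$); $\vdash L$ is valid iff $L$ is. Rules (side conditions are semantic facts that must hold): (Ax1) if $\mathscr b\vDash x_n$ then $\vdash\mathscr b\rightarrowtail\mathbf n$; (Ax2) if $x_n\vDash\mathscr b$ then $\vdash\mathscr b\leftarrowtail\mathbf n$; ($R^{\rightarrowtail}_\cup$) from $\vdash\mathscr c\rightarrowtail A$, $\vdash\mathscr d\rightarrowtail A$ and $\mathscr b\vDash\mathscr c\vee\mathscr d$ infer $\vdash\mathscr b\rightarrowtail A$; ($R^{\leftarrowtail}_\cap$) from $\vdash\mathscr c\leftarrowtail A$, $\vdash\mathscr d\leftarrowtail A$ and $\mathscr c\wedge\mathscr d\vDash\mathscr b$ infer $\vdash\mathscr b\leftarrowtail A$; ($R^{\rightarrowtail}_\neg$) from $\vdash\mathscr c\leftarrowtail A$ and $\mathscr b\vDash\neg\mathscr c$ infer $\vdash\mathscr b\rightarrowtail\neg A$; ($R^{\leftarrowtail}_\neg$) from $\vdash\mathscr c\rightarrowtail A$ and $\neg\mathscr c\vDash\mathscr b$ infer $\vdash\mathscr b\leftarrowtail\neg A$; from $\vdash\mathscr b\rightarrowtail A$ infer $\vdash\mathscr b\rightarrowtail A\vee B$; from $\vdash\mathscr b\rightarrowtail B$ infer $\vdash\mathscr b\rightarrowtail A\vee B$; from $\vdash\mathscr b\leftarrowtail A$ and $\vdash\mathscr b\leftarrowtail B$ infer $\vdash\mathscr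 b\leftarrowtail A\vee B$; from $\vdash\mathscr b\rightarrowtail A$ and $\vdash\mathscr b\rightarrowtail B$ infer $\vdash\mathscr b\rightarrowtail A\wedge B$; from $\vdash\mathscr b\leftarrowtail A$ infer $\vdash\mathscr b\leftarrowtail A\wedge B$; from $\vdash\mathscr b\leftarrowtail B$ infer $\vdash\mathscr b\leftarrowtail A\wedge B$; if $\mu([\![\mathscr b]\!])=0$ then $\vdash\mathscr b\rightarrowtail A$; if $\mu([\![\mathscr b]\!])=1$ then $\vdash\mathscr b\leftarrowtail A$; from $\vdash\mathscr c\rightarrowtail A$ and $\mu([\![\mathscr c]\!])\ge q$ infer $\vdash\mathscr b\rightarrowtail\mathbf C^qA$; from $\vdash\mathscr c\leftarrowtail A$ and $\mu([\![\mathscr c]\!])<q$ infer $\vdash\mathscr b\leftarrowtail\mathbf C^qA$; from $\vdash\mathscr c\leftarrowtail A$ and $\mu([\![\mathscr c]\!])<q$ infer $\vdash\mathscr b\rightarrowtail\mathbf D^qA$; from $\vdash\mathscr c\rightarrowtail A$ and $\mu([\![\mathscr c]\!])\ge q$ infer $\vdash\mathscr b\leftarrowtail\mathbf D^qA$ (in the last four rules $\mathscr b$ is arbitrary). Derivations are defined as usual. -}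

module Defs where

open import Data.Bool using (Bool; true; false; not; _∧_; _∨_; if_then_else_; T)
open import Data.Nat as ℕ using (ℕ; zero; suc; _⊔_; _^_; _≡ᵇ_)
open import Data.Nat.Properties using (m^n≢0)
open import Data.Integer using (+_)
open import Data.Rational using (ℚ; 0ℚ; 1ℚ; _≤ᵇ_; _/_)
import Data.Rational as Q
open import Relation.Binary.PropositionalEquality using (_≡_)

Cantor : Set
Cantor = ℕ → Bool

upd : Cantor → ℕ → Bool → Cantor
upd f n b i = if i ≡ᵇ n then b else f i

-- number of points σ ∈ {0,1}^n (coordinates < n; all others 0) with g σ = true
count : ℕ → (Cantor → Bool) → ℕ
count zero g = if g (λ _ → false) then 1 else 0
count (suc n) g = count n (λ f → g (upd f n true)) ℕ.+ count n (λ f → g (upd f n false))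

-- fair-coin measure of a set depending only on coordinates < n
μ[_] : ℕ → (Cantor → Bool) → ℚ
μ[ n ] g = (+ count n g) / (2 ^ n)
  where instance _ = m^n≢0 2 n

infixr 6 _∧b_ _∨b_
infix 7 ¬b_
infix 3 _⊨_
data BForm : Set where
  x   : ℕ → BForm
  ⊤b  : BForm
  ⊥b  : BForm
  ¬b_ : BForm → BForm
  _∧b_ _∨b_ : BForm → BForm → BForm

⟦_⟧b : BForm → Cantor → Bool
⟦ x i ⟧b f = f i
⟦ ⊤b ⟧b f = true
⟦ ⊥b ⟧b f = false
⟦ ¬b b ⟧b f = not (⟦ b ⟧b f)
⟦ b ∧b c ⟧b f = ⟦ b ⟧b f ∧ ⟦ c ⟧b f
⟦ b ∨b c ⟧b f = ⟦ b ⟧b f ∨ ⟦ c ⟧b f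

-- 1 + largest variable index occurring (semantics depends only on coordinates below it)
bndb : BForm → ℕ
bndb (x i) = suc i
bndb ⊤b = 0
bndb ⊥b = 0
bndb (¬b b) = bndb b
bndb (b ∧b c) = bndb b ⊔ bndb c
bndb (b ∨b c) = bndb b ⊔ bndb c

μb : BForm → ℚ
μb b = μ[ bndb b ] ⟦ b ⟧b

_⊨_ : BForm → BForm → Set
b ⊨ c = ∀ f → T (⟦ b ⟧b f) → T (⟦ c ⟧b f)

infixr 6 _∧f_ _∨f_
infix 7 ¬f_
data Form : Set where
  atom : ℕ → Form
  ¬f_  : Form → Form
  _∧f_ _∨f_ : Form → Form → Form
  C : (q : ℚ) → 0ℚ Q.≤ q → q Q.≤ 1ℚ → Form → Form
  D : (q : ℚ) → 0ℚ Q.≤ q → q Q.≤ 1ℚ → Form → Form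

bnd : Form → ℕ
bnd (atom i) = suc i
bnd (¬f A) = bnd A
bnd (A ∧f B) = bnd A ⊔ bnd B
bnd (A ∨f B) = bnd A ⊔ bnd B
bnd (C q _ _ A) = 0
bnd (D q _ _ A) = 0

⟦_⟧ : Form → Cantor → Bool
⟦ atom i ⟧ f = f i
⟦ ¬f A ⟧ f = not (⟦ A ⟧ f)
⟦ A ∧f B ⟧ f = ⟦ A ⟧ f ∧ ⟦ B ⟧ f
⟦ A ∨f B ⟧ f = ⟦ A ⟧ f ∨ ⟦ B ⟧ f
⟦ C q _ _ A ⟧ f = q ≤ᵇ μ[ bnd A ] ⟦ A ⟧
⟦ D q _ _ A ⟧ f = not (q ≤ᵇ μ[ bnd A ] ⟦ A ⟧)

μf : Form → ℚ
μf A = μ[ bnd A ] ⟦ A ⟧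

infix 4 _↣_ _↢_
infix 2 ⊢_
data Labelled : Set where
  _↣_ : BForm → Form → Labelled
  _↢_ : BForm → Form → Labelled

Valid : Labelled → Set
Valid (b ↣ A) = ∀ f → T (⟦ b ⟧b f) → T (⟦ A ⟧ f)
Valid (b ↢ A) = ∀ f → T (⟦ A ⟧ f) → T (⟦ b ⟧b f)

data ⊢_ : Labelled → Set where
  Ax1 : ∀ {b n} → b ⊨ x n → ⊢ (b ↣ atom n)
  Ax2 : ∀ {b n} → x n ⊨ b → ⊢ (b ↢ atom n)
  R∪ : ∀ {b c d A} → ⊢ (c ↣ A) → ⊢ (d ↣ A) → b ⊨ (c ∨b d) → ⊢ (b ↣ A)
  R∩ : ∀ {b c d A} → ⊢ (c ↢ A) → ⊢ (d ↢ A) → (c ∧b d) ⊨ b → ⊢ (b ↢ A)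
  R¬↣ : ∀ {b c A} → ⊢ (c ↢ A) → b ⊨ (¬b c) → ⊢ (b ↣ ¬f A)
  R¬↢ : ∀ {b c A} → ⊢ (c ↣ A) → (¬b c) ⊨ b → ⊢ (b ↢ ¬f A)
  R∨↣₁ : ∀ {b A B} → ⊢ (b ↣ A) → ⊢ (b ↣ (A ∨f B))
  R∨↣₂ : ∀ {b A B} → ⊢ (b ↣ B) → ⊢ (b ↣ (A ∨f B))
  R∨↢ : ∀ {b A B} → ⊢ (b ↢ A) → ⊢ (b ↢ B) → ⊢ (b ↢ (A ∨f B))
  R∧↣ : ∀ {b A B} → ⊢ (b ↣ A) → ⊢ (b ↣ B) → ⊢ (b ↣ (A ∧f B))
  R∧↢₁ : ∀ {b A B} → ⊢ (b ↢ A) → ⊢ (b ↢ (A ∧f B))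
  R∧↢₂ : ∀ {b A B} → ⊢ (b ↢ B) → ⊢ (b ↢ (A ∧f B))
  Rμ0 : ∀ {b A} → μb b ≡ 0ℚ → ⊢ (b ↣ A)
  Rμ1 : ∀ {b A} → μb b ≡ 1ℚ → ⊢ (b ↢ A)
  RC↣ : ∀ {b c A q p0 p1} → ⊢ (c ↣ A) → q Q.≤ μb c → ⊢ (b ↣ C q p0 p1 A)
  RC↢ : ∀ {b c A q p0 p1} → ⊢ (c ↢ A) → μb c Q.< q → ⊢ (b ↢ C q p0 p1 A)
  RD↣ : ∀ {b c A q p0 p1} → ⊢ (c ↢ A) → μb c Q.< q → ⊢ (b ↣ D q p0 p1 A)
  RD↢ : ∀ {b c A q p0 p1} → ⊢ (c ↣ A) → q Q.≤ μb c → ⊢ (b ↢ D q p0 p1 A)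

{-# OPTIONS --safe #-}
-- Read a labelled formula as an inclusion between the set of a Boolean formula and that of a
-- CPL₀ formula. Every propositional rule is then a lattice law for ⊆ (with complement antitone),
-- so soundness is an induction on derivations once two facts about μ are known: it is monotone
-- under ⊆, and Boolean formulas of measure 0 (resp. 1) denote the empty (resp. full) set. Both
-- hold because all the sets involved are cylinders, depending only on the coordinates below
-- some n. For a cylinder, μ[ n ] does not depend on n (one more coordinate doubles both the
-- count and the denominator), so two cylinders can be compared at a common level; and a
-- cylinder containing some point is counted at least once.
module Submission where

open import Defs
open import Data.Bool using (Bool; true; false; not; _∧_; _∨_; T)
open import Data.Bool.Properties using (T-∧; T-∨)
open import Data.Empty using (⊥-elim)
open import Data.Integer as ℤ using (+_)
import Data.Integer.Properties as ℤP
open import Data.Nat as ℕ using (ℕ; zero; suc; _+_; _*_; _^_; _⊔_; _≤_; _<_; _≤′_; _≡ᵇ_; z≤n; z<s)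
import Data.Nat.Properties as ℕP
open import Algebra.Properties.CommutativeSemigroup ℕP.+-commutativeSemigroup using (interchange)
open import Data.Nat.Tactic.RingSolver using (solve-∀)
open import Data.Product using (_,_; proj₁; proj₂)
open import Data.Rational as ℚ using (0ℚ; 1ℚ; _/_; _≤ᵇ_)
import Data.Rational.Properties as ℚP
open import Data.Rational.Unnormalised using (mkℚᵘ; *≡*; *≤*)
import Data.Rational.Unnormalised.Properties as ℚᵘP
open import Data.Sum using ([_,_]; inj₁; inj₂)
open import Data.Unit using (tt)
open import Function using (_∘′_)
open import Function.Bundles using (Equivalence)
open import Relation.Nullary using (¬_)
open import Relation.Binary.PropositionalEquality hiding ([_])

open Equivalence using (to; from)

/-cross : ∀ a b c d .{{_ : ℕ.NonZero b}} .{{_ : ℕ.NonZero d}} →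
          a * d ≡ c * b → (+ a) / b ≡ (+ c) / d
/-cross a (suc b) c (suc d) ad≡cb = ℚP.fromℚᵘ-cong {mkℚᵘ (+ a) b} {mkℚᵘ (+ c) d} (*≡* (begin
  + a ℤ.* + suc d  ≡⟨ ℤP.pos-* a (suc d) ⟨
  + (a * suc d)    ≡⟨ cong +_ ad≡cb ⟩
  + (c * suc b)    ≡⟨ ℤP.pos-* c (suc b) ⟩
  + c ℤ.* + suc b  ∎))
  where open ≡-Reasoning

/-monoˡ-≤ : ∀ {a c} d .{{_ : ℕ.NonZero d}} → a ≤ c → (+ a) / d ℚ.≤ (+ c) / d
/-monoˡ-≤ {a} {c} (suc d) a≤c = ℚP.toℚᵘ-cancel-≤
  (ℚᵘP.≤-respˡ-≃ (ℚᵘP.≃-sym (ℚP.toℚᵘ-fromℚᵘ (mkℚᵘ (+ a) d)))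
  (ℚᵘP.≤-respʳ-≃ (ℚᵘP.≃-sym (ℚP.toℚᵘ-fromℚᵘ (mkℚᵘ (+ c) d)))
  (*≤* (ℤP.*-monoʳ-≤-nonNeg (+ suc d) (ℤ.+≤+ a≤c)))))

/≡0⇒≡0 : ∀ {c} d .{{_ : ℕ.NonZero d}} → (+ c) / d ≡ 0ℚ → c ≡ 0
/≡0⇒≡0 {c} (suc d) eq =
  trans (sym (ℕP.*-identityʳ c)) (ℚP.normalize-injective-≃ c 0 (suc d) 1 eq)

/≡1⇒≡ : ∀ {c} d .{{_ : ℕ.NonZero d}} → (+ c) / d ≡ 1ℚ → c ≡ d
/≡1⇒≡ {c} (suc d) eq =
  trans (sym (ℕP.*-identityʳ c))
        (trans (ℚP.normalize-injective-≃ c 1 (suc d) 1 eq) (ℕP.*-identityˡ (suc d)))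

<⇒¬≤ᵇ : ∀ {p q} → p ℚ.< q → ¬ T (q ≤ᵇ p)
<⇒¬≤ᵇ p<q q≤ᵇp = ℚP.<-irrefl refl (ℚP.≤-<-trans (ℚP.≤ᵇ⇒≤ q≤ᵇp) p<q)

¬T⇒T-not : ∀ β → ¬ T β → T (not β)
¬T⇒T-not false _ = tt
¬T⇒T-not true ¬t = ¬t tt

T-not⇒¬T : ∀ β → T (not β) → ¬ T β
T-not⇒¬T false _ ()

¬T-not⇒T : ∀ β → ¬ T (not β) → T β
¬T-not⇒T true _ = tt
¬T-not⇒T false ¬t = ¬t tt

module _ {X : Set} where

  infix 4 _⊆_
  infixr 6 _∩_ _∪_

  _⊆_ : (X → Bool) → (X → Bool) → Set
  g ⊆ h = ∀ ω → T (g ω) → T (h ω)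

  _∩_ _∪_ : (X → Bool) → (X → Bool) → X → Bool
  (g ∩ h) ω = g ω ∧ h ω
  (g ∪ h) ω = g ω ∨ h ω

  ∁ : (X → Bool) → X → Bool
  ∁ g ω = not (g ω)

  ⊆-trans : ∀ {g h k} → g ⊆ h → h ⊆ k → g ⊆ k
  ⊆-trans g⊆h h⊆k ω = h⊆k ω ∘′ g⊆h ω

  ∩-greatest : ∀ {g h k} → k ⊆ g → k ⊆ h → k ⊆ g ∩ h
  ∩-greatest k⊆g k⊆h ω kω = from T-∧ (k⊆g ω kω , k⊆h ω kω)

  ∩-lowerˡ : ∀ {g h} → g ∩ h ⊆ g
  ∩-lowerˡ {g} ω = proj₁ ∘′ to (T-∧ {g ω})

  ∩-lowerʳ : ∀ {g h} → g ∩ h ⊆ h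
  ∩-lowerʳ {g} ω = proj₂ ∘′ to (T-∧ {g ω})

  ∪-least : ∀ {g h k} → g ⊆ k → h ⊆ k → g ∪ h ⊆ k
  ∪-least {g} g⊆k h⊆k ω = [ g⊆k ω , h⊆k ω ] ∘′ to (T-∨ {g ω})

  ∪-upperˡ : ∀ {g h} → g ⊆ g ∪ h
  ∪-upperˡ ω = from T-∨ ∘′ inj₁

  ∪-upperʳ : ∀ {g h} → h ⊆ g ∪ h
  ∪-upperʳ {g} ω = from (T-∨ {g ω}) ∘′ inj₂

  ∁-antitone : ∀ {g h} → g ⊆ h → ∁ h ⊆ ∁ g
  ∁-antitone {g} g⊆h ω ¬hω = ¬T⇒T-not (g ω) (T-not⇒¬T _ ¬hω ∘′ g⊆h ω)

  ∅-⊆ : ∀ {g h} → (∀ ω → ¬ T (g ω)) → g ⊆ h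
  ∅-⊆ g-empty ω gω = ⊥-elim (g-empty ω gω)

infix 4 _≈[_]_

_≈[_]_ : Cantor → ℕ → Cantor → Set
f ≈[ n ] f′ = ∀ {i} → i < n → f i ≡ f′ i

Cylinder : ℕ → (Cantor → Bool) → Set
Cylinder n g = ∀ {f f′} → f ≈[ n ] f′ → g f ≡ g f′

cylinder-mono : ∀ {m n g} → m ≤ n → Cylinder m g → Cylinder n g
cylinder-mono m≤n cyl f≈f′ = cyl (λ i<m → f≈f′ (ℕP.<-≤-trans i<m m≤n))

cylinder-∁ : ∀ {n g} → Cylinder n g → Cylinder n (∁ g)
cylinder-∁ cyl f≈f′ = cong not (cyl f≈f′)

cylinder-zipWith : ∀ (_∙_ : Bool → Bool → Bool) {m n g h} → Cylinder m g → Cylinder n h →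
                   Cylinder (m ⊔ n) (λ f → g f ∙ h f)
cylinder-zipWith _∙_ {m} {n} cyl-g cyl-h f≈f′ =
  cong₂ _∙_ (cylinder-mono (ℕP.m≤m⊔n m n) cyl-g f≈f′) (cylinder-mono (ℕP.m≤n⊔m m n) cyl-h f≈f′)

⟦⟧b-cylinder : ∀ b → Cylinder (bndb b) ⟦ b ⟧b
⟦⟧b-cylinder (x i) f≈f′ = f≈f′ (ℕP.n<1+n i)
⟦⟧b-cylinder ⊤b _ = refl
⟦⟧b-cylinder ⊥b _ = refl
⟦⟧b-cylinder (¬b b) = cylinder-∁ (⟦⟧b-cylinder b)
⟦⟧b-cylinder (b ∧b c) = cylinder-zipWith _∧_ (⟦⟧b-cylinder b) (⟦⟧b-cylinder c)
⟦⟧b-cylinder (b ∨b c) = cylinder-zipWith _∨_ (⟦⟧b-cylinder b) (⟦⟧b-cylinder c)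

⟦⟧-cylinder : ∀ A → Cylinder (bnd A) ⟦ A ⟧
⟦⟧-cylinder (atom i) f≈f′ = f≈f′ (ℕP.n<1+n i)
⟦⟧-cylinder (¬f A) = cylinder-∁ (⟦⟧-cylinder A)
⟦⟧-cylinder (A ∧f B) = cylinder-zipWith _∧_ (⟦⟧-cylinder A) (⟦⟧-cylinder B)
⟦⟧-cylinder (A ∨f B) = cylinder-zipWith _∨_ (⟦⟧-cylinder A) (⟦⟧-cylinder B)
⟦⟧-cylinder (C _ _ _ _) _ = refl
⟦⟧-cylinder (D _ _ _ _) _ = refl

≡ᵇ-false⇒≢ : ∀ {i n} → (i ≡ᵇ n) ≡ false → i ≢ n
≡ᵇ-false⇒≢ {i} {n} eq i≡n = subst T eq (ℕP.≡⇒≡ᵇ i n i≡n)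

≡ᵇ-true⇒≡ : ∀ {i n} → (i ≡ᵇ n) ≡ true → i ≡ n
≡ᵇ-true⇒≡ {i} {n} eq = ℕP.≡ᵇ⇒≡ i n (subst T (sym eq) tt)

upd-below : ∀ f n b → upd f n b ≈[ n ] f
upd-below f n b {i} i<n with i ≡ᵇ n in eq
... | true  = ⊥-elim (ℕP.<-irrefl (≡ᵇ-true⇒≡ eq) i<n)
... | false = refl

upd-cong : ∀ {f f′ n} b → f ≈[ n ] f′ → upd f n b ≈[ suc n ] upd f′ n b
upd-cong {n = n} b f≈f′ {i} i<1+n with i ≡ᵇ n in eq
... | true  = refl
... | false = f≈f′ (ℕP.≤∧≢⇒< (ℕ.s≤s⁻¹ i<1+n) (≡ᵇ-false⇒≢ eq))

upd-id : ∀ {f n b} → f n ≡ b → ∀ i → f i ≡ upd f n b i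
upd-id {f} {n} fn≡b i with i ≡ᵇ n in eq
... | true  = trans (cong f (≡ᵇ-true⇒≡ eq)) fn≡b
... | false = refl

count-cong : ∀ n {g h} → (∀ f → g f ≡ h f) → count n g ≡ count n h
count-cong zero    g≗h rewrite g≗h (λ _ → false) = refl
count-cong (suc n) g≗h = cong₂ _+_ (count-cong n (λ _ → g≗h _)) (count-cong n (λ _ → g≗h _))

count-mono : ∀ n {g h} → g ⊆ h → count n g ≤ count n h
count-mono zero {g} {h} g⊆h with g (λ _ → false) | h (λ _ → false) | g⊆h (λ _ → false)
... | false | _     | _   = z≤n
... | true  | true  | _   = ℕP.≤-refl
... | true  | false | g⇒h = ⊥-elim (g⇒h tt)
count-mono (suc n) g⊆h =
  ℕP.+-mono-≤ (count-mono n (λ _ → g⊆h _)) (count-mono n (λ _ → g⊆h _))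

count-suc : ∀ {n g} → Cylinder n g → count (suc n) g ≡ count n g + count n g
count-suc {n} cyl = cong₂ _+_ (count-cong n (λ f → cyl (upd-below f n true)))
                              (count-cong n (λ f → cyl (upd-below f n false)))

count-∁ : ∀ n g → count n g + count n (∁ g) ≡ 2 ^ n
count-∁ zero g with g (λ _ → false)
... | true  = refl
... | false = refl
count-∁ (suc n) g = begin
  (count n g₁ + count n g₀) + (count n (∁ g₁) + count n (∁ g₀))
    ≡⟨ interchange (count n g₁) _ _ _ ⟩
  (count n g₁ + count n (∁ g₁)) + (count n g₀ + count n (∁ g₀))
    ≡⟨ cong₂ _+_ (count-∁ n g₁) (count-∁ n g₀) ⟩
  2 ^ n + 2 ^ n
    ≡⟨ cong (_+_ (2 ^ n)) (ℕP.+-identityʳ (2 ^ n)) ⟨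
  2 ^ suc n ∎
  where
  open ≡-Reasoning
  g₁ g₀ : Cantor → Bool
  g₁ f = g (upd f n true)
  g₀ f = g (upd f n false)

count-positive : ∀ n {g} → Cylinder n g → ∀ f → T (g f) → 0 < count n g
count-positive zero {g} cyl f gf with g (λ _ → false) | subst T (cyl {f} {λ _ → false} λ ()) gf
... | true  | _  = z<s
... | false | ()
count-positive (suc n) {g} cyl f gf = by-coordinate-n (f n) refl
  where
  fibre-positive : ∀ b → f n ≡ b → 0 < count n (λ f′ → g (upd f′ n b))
  fibre-positive b fn≡b = count-positive n (λ f≈f′ → cyl (upd-cong b f≈f′)) f
    (subst T (cyl (λ {i} _ → upd-id fn≡b i)) gf)

  by-coordinate-n : ∀ b → f n ≡ b → 0 < count (suc n) g
  by-coordinate-n true  fn≡1 = ℕP.<-≤-trans (fibre-positive true fn≡1) (ℕP.m≤m+n _ _)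
  by-coordinate-n false fn≡0 = ℕP.<-≤-trans (fibre-positive false fn≡0) (ℕP.m≤n+m _ _)

count≡0⇒empty : ∀ {n g} → Cylinder n g → count n g ≡ 0 → ∀ f → ¬ T (g f)
count≡0⇒empty {n} cyl count≡0 f gf =
  ℕP.<-irrefl (sym count≡0) (count-positive n cyl f gf)

μ-suc : ∀ {n g} → Cylinder n g → μ[ suc n ] g ≡ μ[ n ] g
μ-suc {n} {g} cyl = /-cross (count (suc n) g) (2 ^ suc n) (count n g) (2 ^ n) (begin
  count (suc n) g * 2 ^ n          ≡⟨ cong (λ c → c * 2 ^ n) (count-suc cyl) ⟩
  (count n g + count n g) * 2 ^ n  ≡⟨ double-* (count n g) (2 ^ n) ⟩
  count n g * 2 ^ suc n            ∎)
  where
  open ≡-Reasoning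
  instance _ = ℕP.m^n≢0 2 n
           _ = ℕP.m^n≢0 2 (suc n)
  double-* : ∀ a m → (a + a) * m ≡ a * (2 * m)
  double-* = solve-∀

μ-stable : ∀ {m n g} → Cylinder m g → m ≤′ n → μ[ n ] g ≡ μ[ m ] g
μ-stable cyl ℕ.≤′-refl = refl
μ-stable cyl (ℕ.≤′-step m≤′n) =
  trans (μ-suc (cylinder-mono (ℕP.≤′⇒≤ m≤′n) cyl)) (μ-stable cyl m≤′n)

μ-mono : ∀ {m n g h} → Cylinder m g → Cylinder n h → g ⊆ h → μ[ m ] g ℚ.≤ μ[ n ] h
μ-mono {m} {n} {g} {h} cyl-g cyl-h g⊆h = begin
  μ[ m ] g      ≡⟨ μ-stable cyl-g (ℕP.≤⇒≤′ (ℕP.m≤m⊔n m n)) ⟨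
  μ[ m ⊔ n ] g  ≤⟨ /-monoˡ-≤ (2 ^ (m ⊔ n)) (count-mono (m ⊔ n) g⊆h) ⟩
  μ[ m ⊔ n ] h  ≡⟨ μ-stable cyl-h (ℕP.≤⇒≤′ (ℕP.m≤n⊔m m n)) ⟩
  μ[ n ] h      ∎
  where
  open ℚP.≤-Reasoning
  instance _ = ℕP.m^n≢0 2 (m ⊔ n)

μ≡0⇒empty : ∀ {n g} → Cylinder n g → μ[ n ] g ≡ 0ℚ → ∀ f → ¬ T (g f)
μ≡0⇒empty {n} cyl μ≡0 = count≡0⇒empty cyl (/≡0⇒≡0 (2 ^ n) {{ℕP.m^n≢0 2 n}} μ≡0)

μ≡1⇒full : ∀ {n g} → Cylinder n g → μ[ n ] g ≡ 1ℚ → ∀ f → T (g f)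
μ≡1⇒full {n} {g} cyl μ≡1 f =
  ¬T-not⇒T (g f) (count≡0⇒empty (cylinder-∁ cyl) count-∁≡0 f)
  where
  count-∁≡0 : count n (∁ g) ≡ 0
  count-∁≡0 = ℕP.+-cancelˡ-≡ (count n g) _ _ (begin
    count n g + count n (∁ g)  ≡⟨ count-∁ n g ⟩
    2 ^ n                      ≡⟨ /≡1⇒≡ (2 ^ n) {{ℕP.m^n≢0 2 n}} μ≡1 ⟨
    count n g                  ≡⟨ ℕP.+-identityʳ (count n g) ⟨
    count n g + 0              ∎)
    where open ≡-Reasoning

μb-mono : ∀ c A → ⟦ c ⟧b ⊆ ⟦ A ⟧ → μb c ℚ.≤ μf A
μb-mono c A = μ-mono (⟦⟧b-cylinder c) (⟦⟧-cylinder A)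

μf-mono : ∀ A c → ⟦ A ⟧ ⊆ ⟦ c ⟧b → μf A ℚ.≤ μb c
μf-mono A c = μ-mono (⟦⟧-cylinder A) (⟦⟧b-cylinder c)

proposition1 : (L : Labelled) → ⊢ L → Valid L
proposition1 _ (Ax1 b⊨n) = b⊨n
proposition1 _ (Ax2 n⊨b) = n⊨b
proposition1 _ (R∪ c↣A d↣A b⊨c∨d) =
  ⊆-trans b⊨c∨d (∪-least (proposition1 _ c↣A) (proposition1 _ d↣A))
proposition1 _ (R∩ c↢A d↢A c∧d⊨b) =
  ⊆-trans (∩-greatest (proposition1 _ c↢A) (proposition1 _ d↢A)) c∧d⊨b
proposition1 _ (R¬↣ c↢A b⊨¬c) = ⊆-trans b⊨¬c (∁-antitone (proposition1 _ c↢A))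
proposition1 _ (R¬↢ c↣A ¬c⊨b) = ⊆-trans (∁-antitone (proposition1 _ c↣A)) ¬c⊨b
proposition1 _ (R∨↣₁ b↣A) = ⊆-trans (proposition1 _ b↣A) ∪-upperˡ
proposition1 _ (R∨↣₂ {A = A} b↣B) = ⊆-trans (proposition1 _ b↣B) (∪-upperʳ {g = ⟦ A ⟧})
proposition1 _ (R∨↢ b↢A b↢B) = ∪-least (proposition1 _ b↢A) (proposition1 _ b↢B)
proposition1 _ (R∧↣ b↣A b↣B) = ∩-greatest (proposition1 _ b↣A) (proposition1 _ b↣B)
proposition1 _ (R∧↢₁ {A = A} b↢A) = ⊆-trans (∩-lowerˡ {g = ⟦ A ⟧}) (proposition1 _ b↢A)
proposition1 _ (R∧↢₂ {A = A} b↢B) = ⊆-trans (∩-lowerʳ {g = ⟦ A ⟧}) (proposition1 _ b↢B)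
proposition1 _ (Rμ0 {b} μ≡0) = ∅-⊆ (μ≡0⇒empty (⟦⟧b-cylinder b) μ≡0)
proposition1 _ (Rμ1 {b} μ≡1) f _ = μ≡1⇒full (⟦⟧b-cylinder b) μ≡1 f
proposition1 _ (RC↣ {c = c} {A} c↣A q≤μc) _ _ =
  ℚP.≤⇒≤ᵇ (ℚP.≤-trans q≤μc (μb-mono c A (proposition1 _ c↣A)))
proposition1 _ (RC↢ {c = c} {A} c↢A μc<q) _ q≤ᵇμA =
  ⊥-elim (<⇒¬≤ᵇ (ℚP.≤-<-trans (μf-mono A c (proposition1 _ c↢A)) μc<q) q≤ᵇμA)
proposition1 _ (RD↣ {c = c} {A} c↢A μc<q) _ _ =
  ¬T⇒T-not _ (<⇒¬≤ᵇ (ℚP.≤-<-trans (μf-mono A c (proposition1 _ c↢A)) μc<q))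
proposition1 _ (RD↢ {c = c} {A} c↣A q≤μc) _ q≰ᵇμA =
  ⊥-elim (T-not⇒¬T _ q≰ᵇμA (ℚP.≤⇒≤ᵇ (ℚP.≤-trans q≤μc (μb-mono c A (proposition1 _ c↣A)))))
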